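{- Let $q$ be an indeterminate (or a nonzero complex number that is not a root of unity), let $a,b$ be parameters and $n\ge 0$ an integer. Then, as formal power series in $z$, $$z^n=z^nE\bigl(([n]a+b)z\bigr)+\sum_{k\ge 1}\frac{(-1)^k}{[k]!}\,([n]a+b)\,([n+k]a+b)^{k-1}\,z^{n+k}\,E\bigl(([n+k]a+b)z\bigr).$$
   Context: $[n]=\frac{1-q^n}{1-q}$, $[n]!=\prod_{j=1}^n[j]$, and $E(z)=\sum_{k\ge0}q^{\binom{k}{2}}\frac{z^k}{[k]!}$. (The $k=0$ term of the paper's single sum $\sum_{k\ge0}\frac{(-1)^k}{[k]!}([n]a+b)([n+k]a+b)^{k-1}z^{n+k}E(([n+k]a+b)z)$ is interpreted as $z^nE(([n]a+b)z)$.) -}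

module Defs where

open import Level using (Level)
open import Algebra.Bundles using (CommutativeRing)
open import Data.Nat as ℕ using (ℕ; zero; suc; _<?_; _∸_)
open import Data.Nat.Combinatorics using (_C_)
open import Relation.Nullary using (yes; no)

module QSeries {c ℓ : Level} (R : CommutativeRing c ℓ) (q a b : CommutativeRing.Carrier R) where
  open CommutativeRing R

  pow : Carrier → ℕ → Carrier
  pow x zero    = 1#
  pow x (suc k) = pow x k * x

  sumTo : ℕ → (ℕ → Carrier) → Carrier
  sumTo zero    f = 0#
  sumTo (suc n) f = sumTo n f + f n

  -- [n] = (1 - q^n)/(1 - q) = 1 + q + ... + q^(n-1)
  qint : ℕ → Carrier
  qint n = sumTo n (pow q)

  qfact : ℕ → Carrier
  qfact zero    = 1#
  qfact (suc n) = qfact n * qint (suc n)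

  FPS : Set c
  FPS = ℕ → Carrier

  shiftZ : ℕ → FPS → FPS
  shiftZ m f N with N <? m
  ... | yes _ = 0#
  ... | no  _ = f (N ∸ m)

  scale : Carrier → FPS → FPS
  scale x f N = x * f N

  zpow : ℕ → FPS
  zpow n = shiftZ n (λ { zero → 1# ; (suc _) → 0# })

  -- Given ifac k = 1/[k]!,  E(x z) = Σ_k q^(k choose 2) x^k z^k / [k]!
  E : (ifac : ℕ → Carrier) → Carrier → FPS
  E ifac x k = pow q (k C 2) * pow x k * ifac k

  term : (ifac : ℕ → Carrier) → ℕ → ℕ → FPS
  term ifac n k =
    scale (pow (- 1#) k * ifac k * (qint n * a + b) * pow (qint (n ℕ.+ k) * a + b) (k ∸ 1))
          (shiftZ (n ℕ.+ k) (E ifac (qint (n ℕ.+ k) * a + b)))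

  -- Σ_{k≥1} of a family whose k-th member is divisible by z^k (so the sum
  -- is a well-defined formal power series): coefficient of z^N is the finite
  -- sum over 1 ≤ k ≤ N.
  sumK≥1 : (ℕ → FPS) → FPS
  sumK≥1 t N = sumTo N (λ j → t (suc j) N)

  rhs : (ifac : ℕ → Carrier) → ℕ → FPS
  rhs ifac n N = shiftZ n (E ifac (qint n * a + b)) N + sumK≥1 (term ifac n) N

module Submission where

open import Level using (Level)
open import Algebra.Bundles using (CommutativeRing; RawRing)
open import Algebra.Solver.Ring.AlmostCommutativeRing
  using (_-Raw-AlmostCommutative⟶_; fromCommutativeRing)
open import Data.Empty using (⊥-elim)
open import Data.Maybe using (Maybe; just; nothing)
open import Data.Nat as ℕ using (ℕ; zero; suc; _∸_; _<_; _≤_; _≤′_; _<?_; s≤s; z≤n)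
import Data.Nat.Properties as ℕₚ
open import Data.Nat.Combinatorics using (_C_; nC1≡n; nCk+nC[k+1]≡[n+1]C[k+1])
open import Data.Product using (_×_; _,_)
open import Relation.Binary.PropositionalEquality as ≡ using (_≡_)
open import Relation.Nullary using (Dec; yes; no)

open import Defs

-- Compare coefficients of z^(n+M). For M = 0 both sides are 1. For M = m + 1 the
-- right-hand side is ([n]a+b) times Σ_{k≤M} (−1)^k q^C(M−k,2) / ([k]! [M−k]!) · f k
-- with f k = x_k^m and x_k = [n+k]a+b. By the q-binomial theorem this sum is
-- ((q^(M−1) − T) ⋯ (q^0 − T) f)(0) / [M]!, T the shift. As x_(k+1) = q x_k + const,
-- f is a combination of the sequences k ↦ q^(jk) with j ≤ m < M, each killed by its
-- factor q^j − T, so the sum vanishes.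

-- The ring solver over an arbitrary commutative ring, with coefficients the
-- integers presented as pairs (p , n) standing for p − n; comparing such
-- coefficients is decidable, which lets the solver cancel additive inverses.
module CommutativeRingSolver {c ℓ : Level} (R : CommutativeRing c ℓ) where
  open CommutativeRing R
  open import Algebra.Properties.Semiring.Mult semiring
    using (×-homo-+; ×-homo-1; ×1-homo-*) renaming (_×_ to _×ᵤ_)
  open import Algebra.Properties.Ring ring
    using (x[y-z]≈xy-xz; [y-z]x≈yx-zx; -‿+-comm; ⁻¹-anti-homo‿-; x∙y⁻¹≈ε⇒x≈y; -0#≈0#)
  open import Algebra.Properties.CommutativeSemigroup +-commutativeSemigroup using (interchange)
  open import Relation.Binary.Reasoning.Setoid setoid

  private
    differences : RawRing _ _
    differences = record
      { Carrier = ℕ × ℕ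
      ; _≈_     = _≡_
      ; _+_     = λ { (p , n) (p′ , n′) → p ℕ.+ p′ , n ℕ.+ n′ }
      ; _*_     = λ { (p , n) (p′ , n′) → p ℕ.* p′ ℕ.+ n ℕ.* n′ , p ℕ.* n′ ℕ.+ n ℕ.* p′ }
      ; -_      = λ { (p , n) → n , p }
      ; 0#      = 0 , 0
      ; 1#      = 1 , 0
      }

    ⟦_⟧ : ℕ × ℕ → Carrier
    ⟦ p , n ⟧ = p ×ᵤ 1# - n ×ᵤ 1#

    -‿+-interchange : ∀ x y u v → (x - y) + (u - v) ≈ (x + u) - (y + v)
    -‿+-interchange x y u v = trans (interchange x (- y) u (- v)) (+-congˡ (-‿+-comm y v))

    -‿*-expand : ∀ x y u v → (x - y) * (u - v) ≈ (x * u + y * v) - (x * v + y * u)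
    -‿*-expand x y u v = begin
      (x - y) * (u - v)                   ≈⟨ [y-z]x≈yx-zx (u - v) x y ⟩
      x * (u - v) - y * (u - v)           ≈⟨ +-cong (x[y-z]≈xy-xz x u v) (-‿cong (x[y-z]≈xy-xz y u v)) ⟩
      (x * u - x * v) - (y * u - y * v)   ≈⟨ +-congˡ (⁻¹-anti-homo‿- (y * u) (y * v)) ⟩
      (x * u - x * v) + (y * v - y * u)   ≈⟨ -‿+-interchange (x * u) (x * v) (y * v) (y * u) ⟩
      (x * u + y * v) - (x * v + y * u)   ∎

    -‿cross : ∀ x y u v → x + v ≈ u + y → x - y ≈ u - v
    -‿cross x y u v eq = x∙y⁻¹≈ε⇒x≈y (x - y) (u - v) (begin
      (x - y) - (u - v)       ≈⟨ +-congˡ (⁻¹-anti-homo‿- u v) ⟩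
      (x - y) + (v - u)       ≈⟨ -‿+-interchange x y v u ⟩
      (x + v) - (y + u)       ≈⟨ +-cong eq (-‿cong (+-comm y u)) ⟩
      (u + y) - (u + y)       ≈⟨ -‿inverseʳ (u + y) ⟩
      0#                      ∎)

    homomorphism : differences -Raw-AlmostCommutative⟶ fromCommutativeRing R
    homomorphism = record
      { ⟦_⟧    = ⟦_⟧
      ; +-homo = λ { (p , n) (p′ , n′) → trans
          (+-cong (×-homo-+ 1# p p′) (-‿cong (×-homo-+ 1# n n′)))
          (sym (-‿+-interchange _ _ _ _)) }
      ; *-homo = λ { (p , n) (p′ , n′) → trans
          (+-cong (trans (×-homo-+ 1# (p ℕ.* p′) (n ℕ.* n′)) (+-cong (×1-homo-* p p′) (×1-homo-* n n′)))
                  (-‿cong (trans (×-homo-+ 1# (p ℕ.* n′) (n ℕ.* p′)) (+-cong (×1-homo-* p n′) (×1-homo-* n p′)))))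
          (sym (-‿*-expand _ _ _ _)) }
      ; -‿homo = λ { (p , n) → sym (⁻¹-anti-homo‿- _ _) }
      ; 0-homo = -‿inverseʳ 0#
      ; 1-homo = trans (+-cong (×-homo-1 1#) -0#≈0#) (+-identityʳ 1#)
      }

    ⟦⟧-≈? : ∀ x y → Maybe (⟦ x ⟧ ≈ ⟦ y ⟧)
    ⟦⟧-≈? (p , n) (p′ , n′) with p ℕ.+ n′ ℕ.≟ p′ ℕ.+ n
    ... | yes eq = just (-‿cross _ _ _ _ (trans (sym (×-homo-+ 1# p n′))
                          (trans (reflexive (≡.cong (_×ᵤ 1#) eq)) (×-homo-+ 1# p′ n))))
    ... | no _   = nothing

  open import Algebra.Solver.Ring differences (fromCommutativeRing R) homomorphism ⟦⟧-≈? public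

module Identity {c ℓ : Level} (R : CommutativeRing c ℓ) (q a b : CommutativeRing.Carrier R) where
  open CommutativeRing R
  open QSeries R q a b
  open CommutativeRingSolver R using (solve; _:=_; _:+_; _:*_; :-_; _:-_)
  open import Algebra.Properties.Ring ring using (-1*x≈-x; [y-z]x≈yx-zx; -‿distribˡ-*)
  open import Relation.Binary.Reasoning.Setoid setoid

  sumTo-cong : ∀ n {f g} → (∀ i → i < n → f i ≈ g i) → sumTo n f ≈ sumTo n g
  sumTo-cong zero    eq = refl
  sumTo-cong (suc n) eq = +-cong (sumTo-cong n (λ i i<n → eq i (ℕₚ.m<n⇒m<1+n i<n))) (eq n ℕₚ.≤-refl)

  sumTo-− : ∀ n f g → sumTo n (λ i → f i - g i) ≈ sumTo n f - sumTo n g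
  sumTo-− zero    f g = sym (-‿inverseʳ 0#)
  sumTo-− (suc n) f g = trans (+-congʳ (sumTo-− n f g))
    (solve 4 (λ F G x y → (F :- G) :+ (x :- y) := (F :+ x) :- (G :+ y)) refl _ _ _ _)

  *-distribˡ-sumTo : ∀ n x f → x * sumTo n f ≈ sumTo n (λ i → x * f i)
  *-distribˡ-sumTo zero    x f = zeroʳ x
  *-distribˡ-sumTo (suc n) x f = trans (distribˡ x _ _) (+-congʳ (*-distribˡ-sumTo n x f))

  sumTo-sucˡ : ∀ n f → sumTo (suc n) f ≈ f 0 + sumTo n (λ i → f (suc i))
  sumTo-sucˡ zero    f = trans (+-identityˡ _) (sym (+-identityʳ _))
  sumTo-sucˡ (suc n) f = trans (+-congʳ (sumTo-sucˡ n f)) (+-assoc _ _ _)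

  sumTo-truncate : ∀ {m N} f → m ≤ N → (∀ i → m ≤ i → f i ≈ 0#) → sumTo N f ≈ sumTo m f
  sumTo-truncate {m} f m≤N vanish = go (ℕₚ.≤⇒≤′ m≤N)
    where
    go : ∀ {N} → m ≤′ N → sumTo N f ≈ sumTo m f
    go ℕ.≤′-refl            = refl
    go (ℕ.≤′-step {N} m≤′N) = trans (+-cong (go m≤′N) (vanish N (ℕₚ.≤′⇒≤ m≤′N))) (+-identityʳ _)

  sumTo-shift-− : ∀ m A B →
    sumTo (suc m) A - sumTo (suc m) B ≈ (A 0 + sumTo m (λ i → A (suc i) - B i)) - B m
  sumTo-shift-− m A B = begin
    sumTo (suc m) A - (sumTo m B + B m)
      ≈⟨ +-congʳ (sumTo-sucˡ m A) ⟩
    (A 0 + sumTo m (λ i → A (suc i))) - (sumTo m B + B m)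
      ≈⟨ solve 4 (λ A₀ SA SB Bₘ → (A₀ :+ SA) :- (SB :+ Bₘ) := (A₀ :+ (SA :- SB)) :- Bₘ) refl _ _ _ _ ⟩
    (A 0 + (sumTo m (λ i → A (suc i)) - sumTo m B)) - B m
      ≈⟨ +-congʳ (+-congˡ (sym (sumTo-− m (λ i → A (suc i)) B))) ⟩
    (A 0 + sumTo m (λ i → A (suc i) - B i)) - B m ∎

  pow-cong : ∀ {x y} k → x ≈ y → pow x k ≈ pow y k
  pow-cong zero    eq = refl
  pow-cong (suc k) eq = *-cong (pow-cong k eq) eq

  pow-+ : ∀ x i j → pow x (i ℕ.+ j) ≈ pow x i * pow x j
  pow-+ x zero    j = sym (*-identityˡ _)
  pow-+ x (suc i) j = trans (*-congʳ (pow-+ x i j))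
    (solve 3 (λ A B X → (A :* B) :* X := (A :* X) :* B) refl _ _ _)

  pow-q-[suc-C2] : ∀ t → pow q (suc t C 2) ≈ pow q (t C 2) * pow q t
  pow-q-[suc-C2] t = trans (reflexive (≡.cong (pow q) suc-C2)) (pow-+ q (t C 2) t)
    where
    suc-C2 : suc t C 2 ≡ t C 2 ℕ.+ t
    suc-C2 = ≡.trans (≡.sym (nCk+nC[k+1]≡[n+1]C[k+1] t 1))
               (≡.trans (≡.cong (ℕ._+ (t C 2)) (nC1≡n t)) (ℕₚ.+-comm t (t C 2)))

  qint-suc : ∀ k → qint (suc k) ≈ 1# + q * qint k
  qint-suc zero    = trans (+-identityˡ _) (sym (trans (+-congˡ (zeroʳ q)) (+-identityʳ 1#)))
  qint-suc (suc k) = trans (+-congʳ (qint-suc k))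
    (solve 4 (λ O Q Z P → (O :+ Q :* Z) :+ P :* Q := O :+ Q :* (Z :+ P)) refl 1# q (qint k) (pow q k))

  qint-+ : ∀ s t → qint (s ℕ.+ t) ≈ qint s + pow q s * qint t
  qint-+ zero    t = sym (trans (+-identityˡ _) (*-identityˡ _))
  qint-+ (suc s) t = begin
    qint (suc (s ℕ.+ t))                         ≈⟨ qint-suc (s ℕ.+ t) ⟩
    1# + q * qint (s ℕ.+ t)                      ≈⟨ +-congˡ (*-congˡ (qint-+ s t)) ⟩
    1# + q * (qint s + pow q s * qint t)
      ≈⟨ solve 5 (λ O Q A P B → O :+ Q :* (A :+ P :* B) := (O :+ Q :* A) :+ (P :* Q) :* B)
               refl 1# q (qint s) (pow q s) (qint t) ⟩
    (1# + q * qint s) + pow q (suc s) * qint t   ≈⟨ +-congʳ (sym (qint-suc s)) ⟩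
    qint (suc s) + pow q (suc s) * qint t        ∎

  shiftZ-< : ∀ m f {N} → N < m → shiftZ m f N ≡ 0#
  shiftZ-< m f {N} N<m with N <? m
  ... | yes _   = ≡.refl
  ... | no  N≮m = ⊥-elim (N≮m N<m)

  shiftZ-≥ : ∀ m f {N} → m ≤ N → shiftZ m f N ≡ f (N ∸ m)
  shiftZ-≥ m f {N} m≤N with N <? m
  ... | yes N<m = ⊥-elim (ℕₚ.<⇒≱ N<m m≤N)
  ... | no  _   = ≡.refl

  shiftZ-+ : ∀ m f d → shiftZ m f (m ℕ.+ d) ≡ f d
  shiftZ-+ m f d = ≡.trans (shiftZ-≥ m f (ℕₚ.m≤m+n m d)) (≡.cong f (ℕₚ.m+n∸m≡n m d))

  Δ : ℕ → (ℕ → Carrier) → ℕ → Carrier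
  Δ m f i = pow q m * f i - f (suc i)

  -- f lies in the kernel of (q^0 − T) ⋯ (q^(m−1) − T), spanned by the sequences
  -- i ↦ q^(j i) with j < m.
  QDeg< : ℕ → (ℕ → Carrier) → Set ℓ
  QDeg< zero    f = ∀ i → f i ≈ 0#
  QDeg< (suc m) f = QDeg< m (Δ m f)

  QDeg<-resp : ∀ m {f g} → (∀ i → f i ≈ g i) → QDeg< m f → QDeg< m g
  QDeg<-resp zero    eq f≈0 i = trans (sym (eq i)) (f≈0 i)
  QDeg<-resp (suc m) eq df    = QDeg<-resp m (λ i → +-cong (*-congˡ (eq i)) (-‿cong (eq (suc i)))) df

  QDeg<-+ : ∀ m {f g} → QDeg< m f → QDeg< m g → QDeg< m (λ i → f i + g i)
  QDeg<-+ zero    df dg i = trans (+-cong (df i) (dg i)) (+-identityˡ 0#)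
  QDeg<-+ (suc m) {f} {g} df dg = QDeg<-resp m
    (λ i → solve 5 (λ Q f₀ f₁ g₀ g₁ → (Q :* f₀ :- f₁) :+ (Q :* g₀ :- g₁) := Q :* (f₀ :+ g₀) :- (f₁ :+ g₁))
                   refl (pow q m) (f i) (f (suc i)) (g i) (g (suc i)))
    (QDeg<-+ m df dg)

  QDeg<-scale : ∀ m x {f} → QDeg< m f → QDeg< m (λ i → x * f i)
  QDeg<-scale zero    x df i = trans (*-congˡ (df i)) (zeroʳ x)
  QDeg<-scale (suc m) x {f} df = QDeg<-resp m
    (λ i → solve 4 (λ X Q f₀ f₁ → X :* (Q :* f₀ :- f₁) := Q :* (X :* f₀) :- X :* f₁)
                   refl x (pow q m) (f i) (f (suc i)))
    (QDeg<-scale m x df)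

  QDeg<-shift : ∀ m {f} → QDeg< m f → QDeg< m (λ i → f (suc i))
  QDeg<-shift zero    df i = df (suc i)
  QDeg<-shift (suc m) df   = QDeg<-shift m df

  module _ {v : ℕ → Carrier} {e : Carrier} (v-affine : ∀ i → v (suc i) ≈ q * v i + e) where

    -- Δ (m + 1) (g v) = q · (Δ m g) v − e · T g.
    QDeg<-*affine : ∀ m {g} → QDeg< m g → QDeg< (suc m) (λ i → g i * v i)
    QDeg<-*affine zero {g} g≈0 i = begin
      1# * (g i * v i) - g (suc i) * v (suc i)
        ≈⟨ +-cong (*-congˡ (*-congʳ (g≈0 i))) (-‿cong (*-congʳ (g≈0 (suc i)))) ⟩
      1# * (0# * v i) - 0# * v (suc i)
        ≈⟨ +-cong (trans (*-congˡ (zeroˡ (v i))) (zeroʳ 1#)) (-‿cong (zeroˡ (v (suc i)))) ⟩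
      0# - 0#      ≈⟨ -‿inverseʳ 0# ⟩
      0#           ∎
    QDeg<-*affine (suc m) {g} dg = QDeg<-resp (suc m)
      (λ i → begin
         q * (Δ m g i * v i) + (- e) * g (suc i)
           ≈⟨ solve 6 (λ Q M V E g₀ g₁ → Q :* ((M :* g₀ :- g₁) :* V) :+ (:- E) :* g₁
                                         := (M :* Q) :* (g₀ :* V) :- g₁ :* (Q :* V :+ E))
                      refl q (pow q m) (v i) e (g i) (g (suc i)) ⟩
         pow q (suc m) * (g i * v i) - g (suc i) * (q * v i + e)
           ≈⟨ +-congˡ (-‿cong (*-congˡ (sym (v-affine i)))) ⟩
         pow q (suc m) * (g i * v i) - g (suc i) * v (suc i) ∎)
      (QDeg<-+ (suc m) (QDeg<-scale (suc m) q (QDeg<-*affine m dg))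
                       (QDeg<-scale (suc m) (- e) (QDeg<-shift (suc m) dg)))

    QDeg<-pow : ∀ m → QDeg< (suc m) (λ i → pow (v i) m)
    QDeg<-pow zero    i = trans (+-congʳ (*-identityˡ 1#)) (-‿inverseʳ 1#)
    QDeg<-pow (suc m)   = QDeg<-*affine (suc m) (QDeg<-pow m)

  node : ℕ → Carrier
  node k = qint k * a + b

  node-suc : ∀ k → node (suc k) ≈ q * node k + (a + b - q * b)
  node-suc k = begin
    qint (suc k) * a + b                    ≈⟨ +-congʳ (*-congʳ (qint-suc k)) ⟩
    (1# + q * qint k) * a + b
      ≈⟨ solve 5 (λ O Q Z A B → (O :+ Q :* Z) :* A :+ B := Q :* (Z :* A :+ B) :+ ((O :* A :+ B) :- Q :* B))
               refl 1# q (qint k) a b ⟩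
    q * node k + (1# * a + b - q * b)     ≈⟨ +-congˡ (+-congʳ (+-congʳ (*-identityˡ a))) ⟩
    q * node k + (a + b - q * b)          ∎

  module InverseFactorials (ifac : ℕ → Carrier) (ifac-inverse : ∀ k → qfact k * ifac k ≈ 1#) where

    ifac-zero : ifac 0 ≈ 1#
    ifac-zero = trans (sym (*-identityˡ _)) (ifac-inverse 0)

    ifac-suc : ∀ k → ifac k ≈ qint (suc k) * ifac (suc k)
    ifac-suc k = begin
      ifac k                                              ≈⟨ sym (*-identityʳ _) ⟩
      ifac k * 1#                                         ≈⟨ *-congˡ (sym (ifac-inverse (suc k))) ⟩
      ifac k * (qfact k * qint (suc k) * ifac (suc k))
        ≈⟨ solve 4 (λ I F Q J → I :* (F :* Q :* J) := (F :* I) :* (Q :* J)) refl _ _ _ _ ⟩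
      (qfact k * ifac k) * (qint (suc k) * ifac (suc k))  ≈⟨ *-congʳ (ifac-inverse k) ⟩
      1# * (qint (suc k) * ifac (suc k))                  ≈⟨ *-identityˡ _ ⟩
      qint (suc k) * ifac (suc k)                         ∎

    α : ℕ → Carrier
    α i = pow (- 1#) i * ifac i

    β : ℕ → Carrier
    β j = pow q (j C 2) * ifac j

    α-zero : α 0 ≈ 1#
    α-zero = trans (*-identityˡ _) ifac-zero

    α-suc : ∀ i → qint (suc i) * α (suc i) ≈ - α i
    α-suc i = begin
      qint (suc i) * (pow (- 1#) i * - 1# * ifac (suc i))
        ≈⟨ solve 4 (λ Q S M I → Q :* (S :* M :* I) := M :* (S :* (Q :* I))) refl _ _ (- 1#) _ ⟩
      - 1# * (pow (- 1#) i * (qint (suc i) * ifac (suc i)))  ≈⟨ -1*x≈-x _ ⟩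
      - (pow (- 1#) i * (qint (suc i) * ifac (suc i)))       ≈⟨ -‿cong (*-congˡ (sym (ifac-suc i))) ⟩
      - α i                                                  ∎

    β-suc : ∀ j → qint (suc j) * β (suc j) ≈ pow q j * β j
    β-suc j = begin
      qint (suc j) * (pow q (suc j C 2) * ifac (suc j))         ≈⟨ *-congˡ (*-congʳ (pow-q-[suc-C2] j)) ⟩
      qint (suc j) * (pow q (j C 2) * pow q j * ifac (suc j))
        ≈⟨ solve 4 (λ Q C P I → Q :* (C :* P :* I) := P :* (C :* (Q :* I))) refl _ _ _ _ ⟩
      pow q j * (pow q (j C 2) * (qint (suc j) * ifac (suc j))) ≈⟨ *-congˡ (*-congˡ (sym (ifac-suc j))) ⟩
      pow q j * β j                                             ∎

    E-coefficient : ∀ x k → E ifac x k ≈ β k * pow x k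
    E-coefficient x k = solve 3 (λ C P I → C :* P :* I := C :* I :* P) refl _ _ _

    coefficient-pascal : ∀ {m i} → i < m →
      qint (suc m) * (α (suc i) * β (m ∸ i)) ≈ pow q m * (α (suc i) * β (m ∸ suc i)) - α i * β (m ∸ i)
    coefficient-pascal {suc m} {i} (s≤s i≤m) rewrite ℕₚ.+-∸-assoc 1 i≤m = begin
      qint (suc (suc m)) * (α (suc i) * β (suc t))
        ≈⟨ *-congʳ (reflexive (≡.cong qint suc-suc-m≡)) ⟩
      qint (suc i ℕ.+ suc t) * (α (suc i) * β (suc t))
        ≈⟨ *-congʳ (qint-+ (suc i) (suc t)) ⟩
      (qint (suc i) + pow q (suc i) * qint (suc t)) * (α (suc i) * β (suc t))
        ≈⟨ solve 5 (λ Qi P Qt A B → (Qi :+ P :* Qt) :* (A :* B) := (Qi :* A) :* B :+ (P :* A) :* (Qt :* B))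
                   refl _ _ _ _ _ ⟩
      (qint (suc i) * α (suc i)) * β (suc t) + (pow q (suc i) * α (suc i)) * (qint (suc t) * β (suc t))
        ≈⟨ +-cong (*-congʳ (α-suc i)) (*-congˡ (β-suc t)) ⟩
      (- α i) * β (suc t) + (pow q (suc i) * α (suc i)) * (pow q t * β t)
        ≈⟨ solve 6 (λ A′ B′ P A Pt B → (:- A′) :* B′ :+ (P :* A) :* (Pt :* B) := (P :* Pt) :* (A :* B) :- A′ :* B′)
                   refl _ _ _ _ _ _ ⟩
      (pow q (suc i) * pow q t) * (α (suc i) * β t) - α i * β (suc t)
        ≈⟨ +-congʳ (*-congʳ (sym (trans (reflexive (≡.cong (pow q) suc-m≡)) (pow-+ q (suc i) t)))) ⟩
      pow q (suc m) * (α (suc i) * β t) - α i * β (suc t) ∎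
      where
      t = m ∸ i
      suc-m≡ : suc m ≡ suc i ℕ.+ t
      suc-m≡ = ≡.cong suc (≡.sym (ℕₚ.m+[n∸m]≡n i≤m))
      suc-suc-m≡ : suc (suc m) ≡ suc i ℕ.+ suc t
      suc-suc-m≡ = ≡.trans (≡.cong suc suc-m≡) (≡.sym (ℕₚ.+-suc (suc i) t))

    qBinomialSum : ℕ → (ℕ → Carrier) → Carrier
    qBinomialSum m f = sumTo (suc m) (λ i → α i * β (m ∸ i) * f i)

    qBinomialSum-Δ : ∀ m f → qBinomialSum m (Δ m f) ≈ qint (suc m) * qBinomialSum (suc m) f
    qBinomialSum-Δ m f = begin
      qBinomialSum m (Δ m f)
        ≈⟨ sumTo-cong (suc m) (λ i _ → solve 4 (λ K Q f₀ f₁ → K :* (Q :* f₀ :- f₁) := (Q :* K) :* f₀ :- K :* f₁)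
                                                refl (α i * β (m ∸ i)) (pow q m) (f i) (f (suc i))) ⟩
      sumTo (suc m) (λ i → A i - B i)                         ≈⟨ sumTo-− (suc m) A B ⟩
      sumTo (suc m) A - sumTo (suc m) B                       ≈⟨ sumTo-shift-− m A B ⟩
      (A 0 + sumTo m (λ i → A (suc i) - B i)) - B m           ≈⟨ +-cong (+-cong first (sumTo-cong m middle)) last ⟩
      (G 0 + sumTo m (λ i → G (suc i))) + G (suc m)           ≈⟨ +-congʳ (sym (sumTo-sucˡ m G)) ⟩
      sumTo (suc (suc m)) G                                   ≈⟨ sym (*-distribˡ-sumTo (suc (suc m)) (qint (suc m)) _) ⟩
      qint (suc m) * qBinomialSum (suc m) f                   ∎
      where
      A B G : ℕ → Carrier
      A i = pow q m * (α i * β (m ∸ i)) * f i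
      B i = α i * β (m ∸ i) * f (suc i)
      G i = qint (suc m) * (α i * β (suc m ∸ i) * f i)

      first : A 0 ≈ G 0
      first = begin
        pow q m * (α 0 * β m) * f 0           ≈⟨ *-congʳ (solve 3 (λ Q A B → Q :* (A :* B) := A :* (Q :* B)) refl _ _ _) ⟩
        α 0 * (pow q m * β m) * f 0           ≈⟨ *-congʳ (*-congˡ (sym (β-suc m))) ⟩
        α 0 * (qint (suc m) * β (suc m)) * f 0
          ≈⟨ solve 4 (λ A Q B F → A :* (Q :* B) :* F := Q :* (A :* B :* F)) refl _ _ _ _ ⟩
        G 0                                   ∎

      middle : ∀ i → i < m → A (suc i) - B i ≈ G (suc i)
      middle i i<m = begin
        pow q m * (α (suc i) * β (m ∸ suc i)) * f (suc i) - α i * β (m ∸ i) * f (suc i)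
          ≈⟨ sym ([y-z]x≈yx-zx (f (suc i)) _ _) ⟩
        (pow q m * (α (suc i) * β (m ∸ suc i)) - α i * β (m ∸ i)) * f (suc i)
          ≈⟨ *-congʳ (sym (coefficient-pascal i<m)) ⟩
        qint (suc m) * (α (suc i) * β (m ∸ i)) * f (suc i)
          ≈⟨ *-assoc _ _ _ ⟩
        qint (suc m) * (α (suc i) * β (m ∸ i) * f (suc i)) ∎

      last : - B m ≈ G (suc m)
      last = begin
        - (α m * β (m ∸ m) * f (suc m))       ≈⟨ -‿distribˡ-* _ _ ⟩
        - (α m * β (m ∸ m)) * f (suc m)       ≈⟨ *-congʳ (-‿distribˡ-* _ _) ⟩
        (- α m) * β (m ∸ m) * f (suc m)       ≈⟨ *-congʳ (*-congʳ (sym (α-suc m))) ⟩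
        qint (suc m) * α (suc m) * β (m ∸ m) * f (suc m)
          ≈⟨ solve 4 (λ Q A B F → Q :* A :* B :* F := Q :* (A :* B :* F)) refl _ _ _ _ ⟩
        G (suc m)                             ∎

    qBinomialSum-QDeg< : ∀ m {f} → QDeg< m f → qBinomialSum m f ≈ 0#
    qBinomialSum-QDeg< zero    f≈0 = trans (+-identityˡ _) (trans (*-congˡ (f≈0 0)) (zeroʳ _))
    qBinomialSum-QDeg< (suc m) {f} df = begin
      W                                                    ≈⟨ sym (*-identityˡ W) ⟩
      1# * W                                               ≈⟨ *-congʳ (sym (ifac-inverse (suc m))) ⟩
      qfact m * qint (suc m) * ifac (suc m) * W
        ≈⟨ solve 4 (λ F Q I X → F :* Q :* I :* X := (F :* I) :* (Q :* X)) refl _ _ _ _ ⟩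
      (qfact m * ifac (suc m)) * (qint (suc m) * W)        ≈⟨ *-congˡ (sym (qBinomialSum-Δ m f)) ⟩
      (qfact m * ifac (suc m)) * qBinomialSum m (Δ m f)    ≈⟨ *-congˡ (qBinomialSum-QDeg< m df) ⟩
      (qfact m * ifac (suc m)) * 0#                        ≈⟨ zeroʳ _ ⟩
      0#                                                   ∎
      where W = qBinomialSum (suc m) f

    term-vanishes : ∀ n k {N} → N < n ℕ.+ k → term ifac n k N ≈ 0#
    term-vanishes n k N<n+k = trans (*-congˡ (reflexive (shiftZ-< (n ℕ.+ k) _ N<n+k))) (zeroʳ _)

    sumK≥1-truncate : ∀ n d {N} → d ≤ N → N ≤ n ℕ.+ d →
      sumK≥1 (term ifac n) N ≈ sumTo d (λ j → term ifac n (suc j) N)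
    sumK≥1-truncate n d d≤N N≤n+d = sumTo-truncate _ d≤N
      (λ j d≤j → term-vanishes n (suc j) (ℕₚ.≤-<-trans N≤n+d (ℕₚ.+-monoʳ-< n (s≤s d≤j))))

    rhs-below : ∀ n {N} → N < n → rhs ifac n N ≈ 0#
    rhs-below n {N} N<n = begin
      shiftZ n (E ifac (node n)) N + sumK≥1 (term ifac n) N
        ≈⟨ +-cong (reflexive (shiftZ-< n _ N<n))
                  (sumK≥1-truncate n 0 z≤n (ℕₚ.≤-trans (ℕₚ.<⇒≤ N<n) (ℕₚ.≤-reflexive (≡.sym (ℕₚ.+-identityʳ n))))) ⟩
      0# + 0#  ≈⟨ +-identityʳ 0# ⟩
      0#       ∎

    rhs-at : ∀ n → rhs ifac n (n ℕ.+ 0) ≈ 1#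
    rhs-at n = begin
      shiftZ n (E ifac (node n)) (n ℕ.+ 0) + sumK≥1 (term ifac n) (n ℕ.+ 0)
        ≈⟨ +-cong (reflexive (shiftZ-+ n _ 0)) (sumK≥1-truncate n 0 z≤n ℕₚ.≤-refl) ⟩
      1# * 1# * ifac 0 + 0#     ≈⟨ +-identityʳ _ ⟩
      1# * 1# * ifac 0          ≈⟨ trans (*-congʳ (*-identityˡ 1#)) (*-identityˡ _) ⟩
      ifac 0                    ≈⟨ ifac-zero ⟩
      1#                        ∎

    term-coefficient : ∀ n {m j} → j ≤ m →
      term ifac n (suc j) (n ℕ.+ suc m) ≈ node n * (α (suc j) * β (m ∸ j) * pow (node (n ℕ.+ suc j)) m)
    term-coefficient n {m} {j} j≤m = begin
      α (suc j) * node n * pow v j * shiftZ (n ℕ.+ suc j) (E ifac v) (n ℕ.+ suc m)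
        ≈⟨ *-congˡ (reflexive (≡.trans (shiftZ-≥ (n ℕ.+ suc j) _ (ℕₚ.+-monoʳ-≤ n (s≤s j≤m)))
                                        (≡.cong (E ifac v) (ℕₚ.[m+n]∸[m+o]≡n∸o n (suc m) (suc j))))) ⟩
      α (suc j) * node n * pow v j * E ifac v (m ∸ j)
        ≈⟨ *-congˡ (E-coefficient v (m ∸ j)) ⟩
      α (suc j) * node n * pow v j * (β (m ∸ j) * pow v (m ∸ j))
        ≈⟨ solve 5 (λ A X P B P′ → A :* X :* P :* (B :* P′) := X :* (A :* B :* (P :* P′))) refl _ _ _ _ _ ⟩
      node n * (α (suc j) * β (m ∸ j) * (pow v j * pow v (m ∸ j)))
        ≈⟨ *-congˡ (*-congˡ (sym (pow-+ v j (m ∸ j)))) ⟩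
      node n * (α (suc j) * β (m ∸ j) * pow v (j ℕ.+ (m ∸ j)))
        ≈⟨ *-congˡ (*-congˡ (reflexive (≡.cong (pow v) (ℕₚ.m+[n∸m]≡n j≤m)))) ⟩
      node n * (α (suc j) * β (m ∸ j) * pow v m) ∎
      where v = node (n ℕ.+ suc j)

    rhs-above : ∀ n m → rhs ifac n (n ℕ.+ suc m) ≈ node n * qBinomialSum (suc m) (λ i → pow (node (n ℕ.+ i)) m)
    rhs-above n m = begin
      shiftZ n (E ifac (node n)) N + sumK≥1 (term ifac n) N
        ≈⟨ +-cong (reflexive (shiftZ-+ n _ (suc m))) (sumK≥1-truncate n (suc m) (ℕₚ.m≤n+m (suc m) n) ℕₚ.≤-refl) ⟩
      E ifac (node n) (suc m) + sumTo (suc m) (λ j → term ifac n (suc j) N)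
        ≈⟨ +-cong leading (sumTo-cong (suc m) (λ j j<suc-m → term-coefficient n (ℕₚ.≤-pred j<suc-m))) ⟩
      node n * F 0 + sumTo (suc m) (λ j → node n * F (suc j))
        ≈⟨ sym (trans (*-distribˡ-sumTo (suc (suc m)) (node n) F) (sumTo-sucˡ (suc m) _)) ⟩
      node n * qBinomialSum (suc m) f ∎
      where
      N = n ℕ.+ suc m
      f F : ℕ → Carrier
      f i = pow (node (n ℕ.+ i)) m
      F i = α i * β (suc m ∸ i) * f i

      leading : E ifac (node n) (suc m) ≈ node n * F 0
      leading = begin
        E ifac (node n) (suc m)                       ≈⟨ E-coefficient (node n) (suc m) ⟩
        β (suc m) * (pow (node n) m * node n)
          ≈⟨ solve 3 (λ B P X → B :* (P :* X) := X :* (B :* P)) refl _ _ _ ⟩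
        node n * (β (suc m) * pow (node n) m)
          ≈⟨ *-congˡ (*-cong (sym (trans (*-congʳ α-zero) (*-identityˡ _)))
                              (pow-cong m (reflexive (≡.cong node (≡.sym (ℕₚ.+-identityʳ n)))))) ⟩
        node n * F 0                                  ∎

mainTheorem4 : {c ℓ : Level} (R : CommutativeRing c ℓ) →
    let open CommutativeRing R in
    (q a b : Carrier) (ifac : ℕ → Carrier) →
    (∀ k → QSeries.qfact R q a b k * ifac k ≈ 1#) →
    (n : ℕ) → (N : ℕ) →
    QSeries.zpow R q a b n N ≈ QSeries.rhs R q a b ifac n N
mainTheorem4 R q a b ifac ifac-inverse n N = coefficient (N <? n)
  where
  open CommutativeRing R
  open QSeries R q a b
  open Identity R q a b
  open InverseFactorials ifac ifac-inverse
  open import Relation.Binary.Reasoning.Setoid setoid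

  coefficient : ∀ {N} → Dec (N < n) → zpow n N ≈ rhs ifac n N
  coefficient (yes N<n) = trans (reflexive (shiftZ-< n _ N<n)) (sym (rhs-below n N<n))
  coefficient (no N≮n) with ℕₚ.m≤n⇒∃[o]m+o≡n (ℕₚ.≮⇒≥ N≮n)
  ... | zero  , ≡.refl = trans (reflexive (shiftZ-+ n _ 0)) (sym (rhs-at n))
  ... | suc m , ≡.refl = begin
    zpow n (n ℕ.+ suc m)                                         ≡⟨ shiftZ-+ n _ (suc m) ⟩
    0#                                                           ≈⟨ sym (zeroʳ (node n)) ⟩
    node n * 0#
      ≈⟨ *-congˡ (sym (qBinomialSum-QDeg< (suc m) (QDeg<-pow node-shifted-affine m))) ⟩
    node n * qBinomialSum (suc m) (λ i → pow (node (n ℕ.+ i)) m)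
      ≈⟨ sym (rhs-above n m) ⟩
    rhs ifac n (n ℕ.+ suc m)                                     ∎
    where
    node-shifted-affine : ∀ i → node (n ℕ.+ suc i) ≈ q * node (n ℕ.+ i) + (a + b - q * b)
    node-shifted-affine i = trans (reflexive (≡.cong node (ℕₚ.+-suc n i))) (node-suc (n ℕ.+ i))
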